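{- Let $G$ be an $(m,n)$-mixed graph. Then $\chi_s(G)=2$ if and only if there is a partition $V(G) = X \cup Y$ into two sets such that for all adjacencies $xy, x'y'$ of $U(G)$ with $x,x'\in X$ and $y,y'\in Y$, one of the following holds: (i) $xy$ and $x'y'$ are both edges of $G$ and $c_E(xy)=c_E(x'y')$; (ii) $xy$ and $x'y'$ are both arcs of $G$ (from $x$ to $y$ and from $x'$ to $y'$) and $c_A(xy)=c_A(x'y')$; or (iii) $yx$ and $y'x'$ are both arcs of $G$ (from $y$ to $x$ and from $y'$ to $x'$) and $c_A(yx)=c_A(y'x')$.
   Context: An $(m,n)$-mixed graph $G=(V,A,E)$ is a simple graph (no loops, at most one adjacency between any pair of vertices) in which each adjacency is either an arc or an edge, with colour functions $c_A: A \to \{1,\dots,m\}$, $c_E: E \to \{1,\dots,n\}$; $U(G)$ is its underlying simple graph. A simple homomorphism $\phi: G\to_s H$ is a map $V(G)\to V(H)$ such that either $|V(G)|=1$, or $\phi$ is non-constant and every adjacency $uv$ with $\phi(u)\neq\phi(v)$ is mapped to an adjacency of the same type (edge/arc, same direction, same colour). $\chi_s(G)$ is the least number of vertices of an $(m,n)$-mixed graph $H$ with $G\to_s H$. -}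

module Defs where

open import Data.Nat using (ℕ; _≤_)
open import Data.Fin using (Fin)
open import Data.Bool using (Bool; true; false)
open import Data.Product using (Σ; ∃; ∃-syntax; _×_; _,_)
open import Data.Sum using (_⊎_)
open import Relation.Binary.PropositionalEquality using (_≡_; _≢_)

-- The adjacency between an ordered pair (u , v) of vertices of an
-- (m,n)-mixed graph:
--   none      : u and v are not adjacent
--   edge c    : uv is an edge of colour c
--   arc⁺ c    : uv is an arc from u to v of colour c
--   arc⁻ c    : uv is an arc from v to u of colour c
data Adj (m n : ℕ) : Set where
  none : Adj m n
  edge : Fin n → Adj m n
  arc⁺ : Fin m → Adj m n
  arc⁻ : Fin m → Adj m n

flipAdj : ∀ {m n} → Adj m n → Adj m n
flipAdj none     = none
flipAdj (edge c) = edge c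
flipAdj (arc⁺ c) = arc⁻ c
flipAdj (arc⁻ c) = arc⁺ c

-- A finite (m,n)-mixed graph on vertex set Fin order: simple (no loops,
-- at most one adjacency per pair, which is either an edge or an arc),
-- with arc colours in Fin m and edge colours in Fin n.
record MixedGraph (m n : ℕ) : Set where
  field
    order    : ℕ
    adj      : Fin order → Fin order → Adj m n
    loopless : ∀ v → adj v v ≡ none
    adj-flip : ∀ u v → adj v u ≡ flipAdj (adj u v)

open MixedGraph public

IsSimpleHom : ∀ {m n} (G H : MixedGraph m n) →
              (Fin (order G) → Fin (order H)) → Set
IsSimpleHom G H φ =
  order G ≡ 1
  ⊎ ( (∃[ u ] ∃[ v ] φ u ≢ φ v)
    × (∀ u v → φ u ≢ φ v → adj G u v ≢ none →
         adj H (φ u) (φ v) ≡ adj G u v) )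

_→s_ : ∀ {m n} (G H : MixedGraph m n) → Set
G →s H = Σ (Fin (order G) → Fin (order H)) (IsSimpleHom G H)

χs≡ : ∀ {m n} → MixedGraph m n → ℕ → Set
χs≡ {m} {n} G k =
  (Σ (MixedGraph m n) λ H → (order H ≡ k) × (G →s H))
  × (∀ (H : MixedGraph m n) → G →s H → k ≤ order H)

-- A partition V(G) = X ∪ Y into two (nonempty) sets, X = side⁻¹(true),
-- Y = side⁻¹(false), satisfying the condition of the theorem.
GoodPartition : ∀ {m n} (G : MixedGraph m n) → (Fin (order G) → Bool) → Set
GoodPartition {m} {n} G side =
  (∃[ x ] side x ≡ true) × (∃[ y ] side y ≡ false) ×
  (∀ x y x' y' → side x ≡ true → side x' ≡ true →
     side y ≡ false → side y' ≡ false →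
     adj G x y ≢ none → adj G x' y' ≢ none →
       (∃[ c ] (adj G x y ≡ edge c × adj G x' y' ≡ edge c))
     ⊎ (∃[ c ] (adj G x y ≡ arc⁺ c × adj G x' y' ≡ arc⁺ c))
     ⊎ (∃[ c ] (adj G x y ≡ arc⁻ c × adj G x' y' ≡ arc⁻ c)))

module Submission where

open import Defs
open import Data.Nat using (ℕ; _≤_; z≤n; s≤s)
open import Data.Fin using (Fin; zero; suc)
open import Data.Fin.Properties using (any?) renaming (_≟_ to _≟ᶠ_)
open import Data.Bool using (Bool; true; false; if_then_else_)
open import Data.Bool.Properties using () renaming (_≟_ to _≟ᵇ_)
open import Data.Product using (Σ; _×_; _,_; ∃; ∃-syntax; proj₁; proj₂)
open import Data.Sum using (_⊎_; inj₁; inj₂)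
open import Data.Empty using (⊥-elim)
open import Relation.Nullary using (Dec; yes; no; does; _×-dec_)
open import Relation.Nullary.Decidable using (dec-true)
open import Function using (_∘_)
open import Relation.Binary.PropositionalEquality

-- If χ_s(G) = 2 then G has two vertices (a one-vertex G maps to the one-vertex
-- graph), so a simple homomorphism φ into a two-vertex graph is non-constant and
-- its two fibres partition V(G). Every adjacency between the fibres is sent to the
-- single adjacency of the target, so all of them have the same type and colour.
-- Conversely, such a partition X ∪ Y is the fibre partition of the map sending X
-- and Y to the two vertices of the graph whose only adjacency is the common one
-- across the partition; vertices in different parts force every simple
-- homomorphism from G to be non-constant, so no one-vertex target exists.

SameAdj : ∀ {m n} → Adj m n → Adj m n → Set
SameAdj a b =
    (∃[ c ] (a ≡ edge c × b ≡ edge c))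
  ⊎ (∃[ c ] (a ≡ arc⁺ c × b ≡ arc⁺ c))
  ⊎ (∃[ c ] (a ≡ arc⁻ c × b ≡ arc⁻ c))

SameAdj⇒≡ : ∀ {m n} {a b : Adj m n} → SameAdj a b → a ≡ b
SameAdj⇒≡ (inj₁ (_ , a≡ , b≡))        = trans a≡ (sym b≡)
SameAdj⇒≡ (inj₂ (inj₁ (_ , a≡ , b≡))) = trans a≡ (sym b≡)
SameAdj⇒≡ (inj₂ (inj₂ (_ , a≡ , b≡))) = trans a≡ (sym b≡)

≡⇒SameAdj : ∀ {m n} {a b : Adj m n} → a ≢ none → a ≡ b → SameAdj a b
≡⇒SameAdj {a = none}   a≢none _    = ⊥-elim (a≢none refl)
≡⇒SameAdj {a = edge c} _      refl = inj₁ (c , refl , refl)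
≡⇒SameAdj {a = arc⁺ c} _      refl = inj₂ (inj₁ (c , refl , refl))
≡⇒SameAdj {a = arc⁻ c} _      refl = inj₂ (inj₂ (c , refl , refl))

flipAdj-involutive : ∀ {m n} (a : Adj m n) → flipAdj (flipAdj a) ≡ a
flipAdj-involutive none     = refl
flipAdj-involutive (edge c) = refl
flipAdj-involutive (arc⁺ c) = refl
flipAdj-involutive (arc⁻ c) = refl

≢none? : ∀ {m n} (a : Adj m n) → Dec (a ≢ none)
≢none? none     = no (λ a≢none → a≢none refl)
≢none? (edge c) = yes (λ ())
≢none? (arc⁺ c) = yes (λ ())
≢none? (arc⁻ c) = yes (λ ())

adj-≢none-sym : ∀ {m n} (G : MixedGraph m n) {u v} →
                adj G u v ≢ none → adj G v u ≢ none
adj-≢none-sym G {u} {v} uv≢none vu≡none =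
  uv≢none (trans (adj-flip G v u) (cong flipAdj vu≡none))

Fin1-unique : ∀ {k} → k ≡ 1 → (a b : Fin k) → a ≡ b
Fin1-unique refl zero zero = refl

Fin2-≢⇒≡ : ∀ {k} → k ≡ 2 → {a b c : Fin k} → a ≢ b → a ≢ c → b ≡ c
Fin2-≢⇒≡ refl {zero}     {zero}     {_}        a≢b _   = ⊥-elim (a≢b refl)
Fin2-≢⇒≡ refl {zero}     {suc zero} {zero}     _   a≢c = ⊥-elim (a≢c refl)
Fin2-≢⇒≡ refl {zero}     {suc zero} {suc zero} _   _   = refl
Fin2-≢⇒≡ refl {suc zero} {zero}     {zero}     _   _   = refl
Fin2-≢⇒≡ refl {suc zero} {zero}     {suc zero} _   a≢c = ⊥-elim (a≢c refl)
Fin2-≢⇒≡ refl {suc zero} {suc zero} {_}        a≢b _   = ⊥-elim (a≢b refl)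

Fin-≢⇒2≤ : ∀ {k} {a b : Fin k} → a ≢ b → 2 ≤ k
Fin-≢⇒2≤ {1}         {zero} {zero} a≢b = ⊥-elim (a≢b refl)
Fin-≢⇒2≤ {ℕ.suc (ℕ.suc k)} _           = s≤s (s≤s z≤n)

trivialGraph : ∀ {m n} → MixedGraph m n
trivialGraph = record
  { order = 1 ; adj = λ _ _ → none ; loopless = λ _ → refl ; adj-flip = λ _ _ → refl }

→s-trivialGraph : ∀ {m n} (G : MixedGraph m n) → order G ≡ 1 → G →s trivialGraph
→s-trivialGraph G order≡1 = (λ _ → zero) , inj₁ order≡1

→s-2≤order : ∀ {m n} {G H : MixedGraph m n} {u v : Fin (order G)} →
             G →s H → u ≢ v → 2 ≤ order H
→s-2≤order {u = u} {v} (_ , inj₁ order≡1) u≢v = ⊥-elim (u≢v (Fin1-unique order≡1 u v))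
→s-2≤order (_ , inj₂ ((_ , _ , φu≢φv) , _)) _ = Fin-≢⇒2≤ φu≢φv

module FibrePartition {m n} (G H : MixedGraph m n) (orderH≡2 : order H ≡ 2)
  (φ : Fin (order G) → Fin (order H))
  (preserves : ∀ u v → φ u ≢ φ v → adj G u v ≢ none → adj H (φ u) (φ v) ≡ adj G u v)
  (x₀ y₀ : Fin (order G)) (φx₀≢φy₀ : φ x₀ ≢ φ y₀) where

  side : Fin (order G) → Bool
  side u = does (φ u ≟ᶠ φ x₀)

  side-true : ∀ {u} → side u ≡ true → φ u ≡ φ x₀
  side-true {u} _  with φ u ≟ᶠ φ x₀
  ... | yes φu≡φx₀ = φu≡φx₀

  side-false : ∀ {u} → side u ≡ false → φ u ≢ φ x₀
  side-false {u} e φu≡φx₀ with () ← trans (sym (dec-true (φ u ≟ᶠ φ x₀) φu≡φx₀)) e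

  goodPartition : GoodPartition G side
  goodPartition =
    (x₀ , dec-true (φ x₀ ≟ᶠ φ x₀) refl) ,
    (y₀ , side-y₀) ,
    λ x y x' y' sx sx' sy sy' xy≢none x'y'≢none →
      ≡⇒SameAdj xy≢none (begin
        adj G x y             ≡⟨ sym (preserves x y (cross sx sy) xy≢none) ⟩
        adj H (φ x) (φ y)     ≡⟨ cong₂ (adj H) (trans (side-true sx) (sym (side-true sx')))
                                               (Fin2-≢⇒≡ orderH≡2 (φx₀≢φ sy) (φx₀≢φ sy')) ⟩
        adj H (φ x') (φ y')   ≡⟨ preserves x' y' (cross sx' sy') x'y'≢none ⟩
        adj G x' y'           ∎)
    where
    open ≡-Reasoning

    side-y₀ : side y₀ ≡ false
    side-y₀ with φ y₀ ≟ᶠ φ x₀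
    ... | yes φy₀≡φx₀ = ⊥-elim (φx₀≢φy₀ (sym φy₀≡φx₀))
    ... | no _        = refl

    φx₀≢φ : ∀ {y} → side y ≡ false → φ x₀ ≢ φ y
    φx₀≢φ sy φx₀≡φy = side-false sy (sym φx₀≡φy)

    cross : ∀ {x y} → side x ≡ true → side y ≡ false → φ x ≢ φ y
    cross sx sy φx≡φy = side-false sy (trans (sym φx≡φy) (side-true sx))

χs≡2⇒GoodPartition : ∀ {m n} (G : MixedGraph m n) →
                     χs≡ G 2 → Σ (Fin (order G) → Bool) (GoodPartition G)
χs≡2⇒GoodPartition G ((H , _ , _ , inj₁ order≡1) , minimal)
  with minimal trivialGraph (→s-trivialGraph G order≡1)
... | s≤s ()
χs≡2⇒GoodPartition G ((H , orderH≡2 , φ , inj₂ ((x₀ , y₀ , φx₀≢φy₀) , preserves)) , _) =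
  side , goodPartition
  where open FibrePartition G H orderH≡2 φ preserves x₀ y₀ φx₀≢φy₀

twoVertexGraph : ∀ {m n} → Adj m n → MixedGraph m n
twoVertexGraph {m} {n} a = record
  { order = 2 ; adj = adj₂ ; loopless = loopless₂ ; adj-flip = adj-flip₂ }
  where
  adj₂ : Fin 2 → Fin 2 → Adj m n
  adj₂ zero       (suc zero) = a
  adj₂ (suc zero) zero       = flipAdj a
  adj₂ _          _          = none

  loopless₂ : ∀ v → adj₂ v v ≡ none
  loopless₂ zero       = refl
  loopless₂ (suc zero) = refl

  adj-flip₂ : ∀ u v → adj₂ v u ≡ flipAdj (adj₂ u v)
  adj-flip₂ zero       zero       = refl
  adj-flip₂ zero       (suc zero) = refl
  adj-flip₂ (suc zero) zero       = sym (flipAdj-involutive a)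
  adj-flip₂ (suc zero) (suc zero) = refl

module TwoVertexQuotient {m n} (G : MixedGraph m n) (side : Fin (order G) → Bool)
  (good : GoodPartition G side) where

  CrossAdjacent : Fin (order G) → Set
  CrossAdjacent x = ∃[ y ] (side x ≡ true × side y ≡ false × adj G x y ≢ none)

  crossAdjacent? : Dec (∃ CrossAdjacent)
  crossAdjacent? = any? (λ x → any? (λ y →
    (side x ≟ᵇ true) ×-dec (side y ≟ᵇ false) ×-dec ≢none? (adj G x y)))

  crossAdj : Adj m n
  crossAdj with crossAdjacent?
  ... | yes (x , y , _) = adj G x y
  ... | no _            = none

  crossAdj-spec : ∀ u v → side u ≡ true → side v ≡ false → adj G u v ≢ none →
                  crossAdj ≡ adj G u v
  crossAdj-spec u v su sv uv≢none with crossAdjacent?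
  ... | yes (x , y , sx , sy , xy≢none) =
          SameAdj⇒≡ (proj₂ (proj₂ good) x y u v sx su sy sv xy≢none uv≢none)
  ... | no ¬cross = ⊥-elim (¬cross (u , v , su , sv , uv≢none))

  φ : Fin (order G) → Fin 2
  φ u = if side u then zero else suc zero

  preserves : ∀ u v → φ u ≢ φ v → adj G u v ≢ none →
              adj (twoVertexGraph crossAdj) (φ u) (φ v) ≡ adj G u v
  preserves u v φu≢φv uv≢none with side u in su | side v in sv
  ... | true  | true  = ⊥-elim (φu≢φv refl)
  ... | false | false = ⊥-elim (φu≢φv refl)
  ... | true  | false = crossAdj-spec u v su sv uv≢none
  ... | false | true  = begin
    flipAdj crossAdj    ≡⟨ cong flipAdj (crossAdj-spec v u sv su (adj-≢none-sym G uv≢none)) ⟩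
    flipAdj (adj G v u) ≡⟨ adj-flip G v u ⟨
    adj G u v           ∎
    where open ≡-Reasoning

  x₀ y₀ : Fin (order G)
  x₀ = proj₁ (proj₁ good)
  y₀ = proj₁ (proj₁ (proj₂ good))

  side-x₀≢side-y₀ : side x₀ ≢ side y₀
  side-x₀≢side-y₀ rewrite proj₂ (proj₁ good) | proj₂ (proj₁ (proj₂ good)) = λ ()

  φx₀≢φy₀ : φ x₀ ≢ φ y₀
  φx₀≢φy₀ rewrite proj₂ (proj₁ good) | proj₂ (proj₁ (proj₂ good)) = λ ()

  χs≡2 : χs≡ G 2
  χs≡2 = (twoVertexGraph crossAdj , refl , φ , inj₂ ((x₀ , y₀ , φx₀≢φy₀) , preserves)) ,
         λ H G→sH → →s-2≤order {G = G} {H} G→sH (side-x₀≢side-y₀ ∘ cong side)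

mainTheorem5 : ∀ {m n : ℕ} (G : MixedGraph m n) →
    (χs≡ G 2 → Σ (Fin (order G) → Bool) (GoodPartition G))
    × (Σ (Fin (order G) → Bool) (GoodPartition G) → χs≡ G 2)
mainTheorem5 G = χs≡2⇒GoodPartition G , λ (side , good) → TwoVertexQuotient.χs≡2 G side good
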